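{- Let $R$ be the road of width $w$ and length $\ell$. Any minimal blocking set $B$ of $R$ that spreads over $d$ layers has $|B|\ge d+q-1$, where $q$ is the number of vertices of $R$ in the highest layer that $B$ intersects.
   Context: The chain of width $w$ and length $\ell$ has layers $0,\dots,\ell$, each with $w$ vertices indexed $0,\dots,w-1$; for $i\ge1$ the $k$-th vertex of layer $i$ has incoming edges from the $k$-th and $((k+1)\bmod w)$-th vertices of layer $i-1$. For $\ell\ge w-1$, the road of width $w$ and length $\ell$ is the subgraph of the chain of width $w$ and length $\ell$ induced by a fixed sink $z$ (a vertex of layer $\ell$) together with all vertices having a directed path to $z$; layers are indexed as in the chain (equivalently, a chain of width $w$ and length $\ell-w+1$ whose sinks are identified with the sources of a pyramid of height $w-1$). A blocking set of a single-sink DAG is a set $B$ of vertices such that every directed path from a source to the sink contains a vertex of $B$; it is minimal if no proper subset is a blocking set. $B$ spreads over $d$ layers if $a,b$ are the lowest and highest layers containing a vertex of $B$ and $d=b-a+1$. -}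

module Defs where

open import Data.Nat using (ℕ; zero; suc; _+_; _∸_; _≤_)
open import Data.Fin using (Fin; toℕ; fromℕ)
open import Data.Bool using (Bool; true; false)
open import Data.List using (List; []; _∷_; length; cartesianProduct; allFin)
open import Data.List.Relation.Unary.Any using (Any)
open import Data.List.Relation.Unary.Unique.Propositional using (Unique)
open import Data.List.Membership.Propositional using (_∈_)
open import Data.Product using (Σ; _×_; _,_; proj₁; proj₂; ∃-syntax)
open import Data.Sum using (_⊎_)
open import Relation.Nullary using (¬_)
open import Relation.Binary.PropositionalEquality using (_≡_)
open import Function.Bundles using (_⇔_)

-- Vertices of the chain of width w and length ℓ: (layer i ∈ {0..ℓ}, index k ∈ {0..w-1}).
V : ℕ → ℕ → Set
V ℓ w = Fin (suc ℓ) × Fin w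

layer : ∀ {ℓ w} → V ℓ w → ℕ
layer v = toℕ (proj₁ v)

idx : ∀ {ℓ w} → V ℓ w → ℕ
idx v = toℕ (proj₂ v)

-- k' ≡ (k + 1) mod w, for k < w
IsSuccMod : ℕ → ℕ → ℕ → Set
IsSuccMod w k k' = (k' ≡ suc k × suc k ≤ w ∸ 1) ⊎ (k' ≡ 0 × suc k ≡ w)

Edge : ∀ {ℓ w} → V ℓ w → V ℓ w → Set
Edge {ℓ} {w} u v = layer v ≡ suc (layer u) × (idx u ≡ idx v ⊎ IsSuccMod w (idx v) (idx u))

data Path {ℓ w : ℕ} : V ℓ w → V ℓ w → Set where
  here : ∀ {v} → Path v v
  step : ∀ {u v t} → Edge u v → Path v t → Path u t

verts : ∀ {ℓ w} {u t : V ℓ w} → Path u t → List (V ℓ w)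
verts {u = u} here = u ∷ []
verts {u = u} (step e p) = u ∷ verts p

sinkV : ∀ {ℓ w} → Fin w → V ℓ w
sinkV {ℓ} z = (fromℕ ℓ , z)

InRoad : ∀ {ℓ w} → Fin w → V ℓ w → Set
InRoad z v = Path v (sinkV z)

IsSource : ∀ {ℓ w} → Fin w → V ℓ w → Set
IsSource z v = InRoad z v × (∀ u → Edge u v → ¬ InRoad z u)

VSet : ℕ → ℕ → Set
VSet ℓ w = V ℓ w → Bool

_∈ₛ_ : ∀ {ℓ w} → V ℓ w → VSet ℓ w → Set
v ∈ₛ B = B v ≡ true

_⊆ₛ_ : ∀ {ℓ w} → VSet ℓ w → VSet ℓ w → Set
B ⊆ₛ C = ∀ v → v ∈ₛ B → v ∈ₛ C

SubsetOfRoad : ∀ {ℓ w} → Fin w → VSet ℓ w → Set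
SubsetOfRoad z B = ∀ v → v ∈ₛ B → InRoad z v

-- Blocking set: every directed path (in the road) from a source to the sink meets B.
-- (Every path ending at the sink lies in the road automatically.)
Blocking : ∀ {ℓ w} → Fin w → VSet ℓ w → Set
Blocking z B = SubsetOfRoad z B ×
  (∀ s → IsSource z s → (p : Path s (sinkV z)) → Any (λ x → x ∈ₛ B) (verts p))

MinimalBlocking : ∀ {ℓ w} → Fin w → VSet ℓ w → Set
MinimalBlocking z B = Blocking z B ×
  (∀ B' → B' ⊆ₛ B → (∃[ x ] (x ∈ₛ B × ¬ (x ∈ₛ B'))) → ¬ Blocking z B')

allV : ∀ ℓ w → List (V ℓ w)
allV ℓ w = cartesianProduct (allFin (suc ℓ)) (allFin w)

countTrue : ∀ {A : Set} → (A → Bool) → List A → ℕ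
countTrue f [] = 0
countTrue f (x ∷ xs) with f x
... | true = suc (countTrue f xs)
... | false = countTrue f xs

card : ∀ {ℓ w} → VSet ℓ w → ℕ
card {ℓ} {w} B = countTrue B (allV ℓ w)

LowestLayer : ∀ {ℓ w} → VSet ℓ w → ℕ → Set
LowestLayer B a = (∃[ x ] (x ∈ₛ B × layer x ≡ a)) × (∀ x → x ∈ₛ B → a ≤ layer x)

HighestLayer : ∀ {ℓ w} → VSet ℓ w → ℕ → Set
HighestLayer B b = (∃[ x ] (x ∈ₛ B × layer x ≡ b)) × (∀ x → x ∈ₛ B → layer x ≤ b)

EnumRoadLayer : ∀ {ℓ w} → Fin w → ℕ → List (V ℓ w) → Set
EnumRoadLayer z b L = Unique L × (∀ v → (v ∈ L) ⇔ (InRoad z v × layer v ≡ b))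

-- Let D be the set of vertices joined to the sink by a path avoiding B (FreeToSink) and U the set
-- of vertices joined to layer 0 by such a path (FreeFromBottom); as B is blocking, D ∩ U = ∅.
-- By minimality every x ∈ B has an in-neighbour in U (or lies in layer 0) and an out-neighbour
-- in D (or is the sink). Let a ≤ b be the lowest and highest layers meeting B. Row a misses D, and
-- every road vertex of row b lies in D ∪ B. For a ≤ j < b, row j+1 meets D (above the lowest
-- blocker) and its complement (below the highest one), so around the cyclic row there is k ∈ D
-- with k+1 ∉ D. Both in-neighbours of a D-vertex lie in D ∪ B, so sending each D-vertex of row
-- j+1 to the vertex of row j with the same index lands in D ∪ B and misses index k+1, which is in
-- D ∪ B as an in-neighbour of k: |D ∩ row j| + |B ∩ row j| ≥ |D ∩ row (j+1)| + 1. Telescoping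
-- from a to b gives |B| ≥ (b − a) + q.

module Submission where

open import Defs
open import Data.Bool using (Bool; true; false; _∧_; _∨_; not)
import Data.Bool.Properties as Bool
open import Data.Bool.Properties
  using ( ¬-not; not-¬; ∧-conicalˡ; ∧-conicalʳ; ∧-distribˡ-∨; ∧-distribʳ-∨; ∧-zeroʳ
        ; ∨-zeroʳ; ∨-identityʳ)
open import Data.Empty using (⊥; ⊥-elim)
open import Data.Fin using (Fin; toℕ)
import Data.Fin as Fin
open import Data.Fin.Properties using (toℕ-injective; toℕ<n; toℕ-fromℕ; toℕ-fromℕ<)
open import Data.List using (List; []; _∷_; length; _++_; map; cartesianProduct; allFin)
open import Data.List.Membership.Propositional using (_∈_)
open import Data.List.Membership.Propositional.Properties using (∈-allFin; ∈-cartesianProduct⁺)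
open import Data.List.Relation.Unary.All as All using (All; []; _∷_)
open import Data.List.Relation.Unary.All.Properties using (All¬⇒¬Any; ¬Any⇒All¬)
open import Data.List.Relation.Unary.AllPairs using ([]; _∷_)
open import Data.List.Relation.Unary.Any as Any using (Any; here; there; any?)
open import Data.List.Relation.Unary.Unique.Propositional using (Unique)
open import Data.List.Relation.Unary.Unique.Propositional.Properties using (allFin⁺)
open import Data.Nat
  using (ℕ; zero; suc; _+_; _∸_; _≤_; _<_; _≤?_; _≤′_; ≤′-refl; ≤′-step; z≤n; s≤s; s≤s⁻¹)
open import Data.Nat.DivMod using (_mod_; m<n⇒m%n≡m)
open import Data.Nat.Properties
open import Data.Product using (Σ; _×_; _,_; proj₁; proj₂; ∃-syntax; ∃₂)
open import Data.Product.Properties using (≡-dec)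
open import Data.Sum using (_⊎_; inj₁; inj₂; [_,_]′)
open import Effect.Monad using (RawMonad)
open import Function using (_∘_; _⇔_; mk⇔; Equivalence; case_of_)
open import Relation.Binary.Definitions using (DecidableEquality)
open import Relation.Binary.PropositionalEquality
open import Relation.Nullary using (¬_; Dec; yes; no; does; contradiction)
open import Relation.Nullary.Decidable
  using (dec-true; dec-false; does-⇔; _⊎-dec_; decidable-stable; ¬¬-excluded-middle)
open import Relation.Nullary.Negation using (¬¬-Monad)

does⇒ : ∀ {P : Set} (P? : Dec P) → does P? ≡ true → P
does⇒ (yes p) _ = p

module _ {A : Set} where

  countTrue-cong : ∀ {f g : A → Bool} → (∀ x → f x ≡ g x) → ∀ xs → countTrue f xs ≡ countTrue g xs
  countTrue-cong f≗g [] = refl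
  countTrue-cong {g = g} f≗g (x ∷ xs) rewrite f≗g x with g x
  ... | true  = cong suc (countTrue-cong f≗g xs)
  ... | false = countTrue-cong f≗g xs

  countTrue-false : ∀ {f : A → Bool} → (∀ x → f x ≡ false) → ∀ xs → countTrue f xs ≡ 0
  countTrue-false f≡false [] = refl
  countTrue-false f≡false (x ∷ xs) rewrite f≡false x = countTrue-false f≡false xs

  countTrue-mono : ∀ {f g : A → Bool} → (∀ x → f x ≡ true → g x ≡ true) → ∀ xs →
    countTrue f xs ≤ countTrue g xs
  countTrue-mono f⇒g [] = z≤n
  countTrue-mono {f} {g} f⇒g (x ∷ xs) with f x in fx | g x in gx
  ... | true  | true  = s≤s (countTrue-mono f⇒g xs)
  ... | true  | false with () ← trans (sym (f⇒g x fx)) gx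
  ... | false | true  = m≤n⇒m≤1+n (countTrue-mono f⇒g xs)
  ... | false | false = countTrue-mono f⇒g xs

  countTrue-mono-< : ∀ {f g : A → Bool} → (∀ x → f x ≡ true → g x ≡ true) → ∀ xs →
    Any (λ x → f x ≡ false × g x ≡ true) xs → countTrue f xs < countTrue g xs
  countTrue-mono-< f⇒g (x ∷ xs) (here (fx , gx)) rewrite fx | gx = s≤s (countTrue-mono f⇒g xs)
  countTrue-mono-< {f} {g} f⇒g (x ∷ xs) (there witness) with f x in fx | g x in gx
  ... | true  | true  = s≤s (countTrue-mono-< f⇒g xs witness)
  ... | true  | false with () ← trans (sym (f⇒g x fx)) gx
  ... | false | true  = m≤n⇒m≤1+n (countTrue-mono-< f⇒g xs witness)
  ... | false | false = countTrue-mono-< f⇒g xs witness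

  countTrue-∨-∧ : ∀ (f g : A → Bool) xs →
    countTrue (λ x → f x ∨ g x) xs + countTrue (λ x → f x ∧ g x) xs ≡ countTrue f xs + countTrue g xs
  countTrue-∨-∧ f g [] = refl
  countTrue-∨-∧ f g (x ∷ xs) with f x | g x
  ... | true  | true  = cong suc (trans (+-suc _ _) (trans (cong suc IH) (sym (+-suc _ _))))
    where IH = countTrue-∨-∧ f g xs
  ... | true  | false = cong suc (countTrue-∨-∧ f g xs)
  ... | false | true  = trans (cong suc (countTrue-∨-∧ f g xs)) (sym (+-suc _ _))
  ... | false | false = countTrue-∨-∧ f g xs

  countTrue-∨ : ∀ (f g : A → Bool) xs →
    countTrue (λ x → f x ∨ g x) xs ≤ countTrue f xs + countTrue g xs
  countTrue-∨ f g xs = ≤-trans (m≤m+n _ _) (≤-reflexive (countTrue-∨-∧ f g xs))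

  countTrue-disjoint : ∀ {f g : A → Bool} → (∀ x → f x ∧ g x ≡ false) → ∀ xs →
    countTrue f xs + countTrue g xs ≡ countTrue (λ x → f x ∨ g x) xs
  countTrue-disjoint {f} {g} disjoint xs = begin
    countTrue f xs + countTrue g xs                                  ≡⟨ countTrue-∨-∧ f g xs ⟨
    countTrue f∨g xs + countTrue (λ x → f x ∧ g x) xs                ≡⟨ cong (countTrue f∨g xs +_)
                                                                          (countTrue-false disjoint xs) ⟩
    countTrue f∨g xs + 0                                             ≡⟨ +-identityʳ _ ⟩
    countTrue f∨g xs                                                 ∎
    where
    open ≡-Reasoning
    f∨g : A → Bool
    f∨g x = f x ∨ g x

  countTrue-++ : ∀ (f : A → Bool) xs ys → countTrue f (xs ++ ys) ≡ countTrue f xs + countTrue f ys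
  countTrue-++ f [] ys = refl
  countTrue-++ f (x ∷ xs) ys with f x
  ... | true  = cong suc (countTrue-++ f xs ys)
  ... | false = countTrue-++ f xs ys

countTrue-map : ∀ {A C : Set} (f : C → Bool) (g : A → C) xs →
  countTrue f (map g xs) ≡ countTrue (f ∘ g) xs
countTrue-map f g [] = refl
countTrue-map f g (x ∷ xs) with f (g x)
... | true  = cong suc (countTrue-map f g xs)
... | false = countTrue-map f g xs

module _ {A C : Set} where

  countTrue-cartesianProduct-∷ : ∀ (F : A × C → Bool) x xs ys →
    countTrue F (cartesianProduct (x ∷ xs) ys)
      ≡ countTrue (λ y → F (x , y)) ys + countTrue F (cartesianProduct xs ys)
  countTrue-cartesianProduct-∷ F x xs ys =
    trans (countTrue-++ F (map (x ,_) ys) (cartesianProduct xs ys)) (cong (_+ _) (countTrue-map F (x ,_) ys))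

module _ {A C : Set} {F : A × C → Bool} {c : A} (off-row : ∀ x y → c ≢ x → F (x , y) ≡ false) where

  private
    countTrue-off-rows : ∀ {xs} → All (c ≢_) xs → ∀ ys → countTrue F (cartesianProduct xs ys) ≡ 0
    countTrue-off-rows [] ys = refl
    countTrue-off-rows {x ∷ xs} (c≢x ∷ c∉xs) ys = trans (countTrue-cartesianProduct-∷ F x xs ys)
      (cong₂ _+_ (countTrue-false (λ y → off-row x y c≢x) ys) (countTrue-off-rows c∉xs ys))

  countTrue-cartesianProduct : ∀ {xs} → Unique xs → c ∈ xs → ∀ ys →
    countTrue F (cartesianProduct xs ys) ≡ countTrue (λ y → F (c , y)) ys
  countTrue-cartesianProduct {x ∷ xs} (x∉xs ∷ _) (here refl) ys =
    trans (countTrue-cartesianProduct-∷ F x xs ys)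
          (trans (cong (_ +_) (countTrue-off-rows x∉xs ys)) (+-identityʳ _))
  countTrue-cartesianProduct {x ∷ xs} (x∉xs ∷ unique) (there c∈xs) ys =
    trans (countTrue-cartesianProduct-∷ F x xs ys)
          (cong₂ _+_ (countTrue-false (λ y → off-row x y (≢-sym (All.lookup x∉xs c∈xs))) ys)
                     (countTrue-cartesianProduct unique c∈xs ys))

module _ {A : Set} (_≟_ : DecidableEquality A) where
  open import Data.List.Membership.DecPropositional _≟_ using (_∈?_)

  private
    length≤countTrue-∈ : ∀ {xs} → Unique xs → ∀ ys → (∀ x → x ∈ ys) →
      length xs ≤ countTrue (λ x → does (x ∈? xs)) ys
    length≤countTrue-∈ [] ys _ = z≤n
    length≤countTrue-∈ {x ∷ xs} (x∉xs ∷ unique) ys complete =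
      ≤-trans (s≤s (length≤countTrue-∈ unique ys complete))
              (countTrue-mono-< ∈xs⇒∈x∷xs ys (Any.map (λ { refl → new }) (complete x)))
      where
      ∈xs⇒∈x∷xs : ∀ v → does (v ∈? xs) ≡ true → does (v ∈? (x ∷ xs)) ≡ true
      ∈xs⇒∈x∷xs v v∈xs = dec-true (v ∈? (x ∷ xs)) (there (does⇒ (v ∈? xs) v∈xs))
      new : does (x ∈? xs) ≡ false × does (x ∈? (x ∷ xs)) ≡ true
      new = dec-false (x ∈? xs) (λ x∈xs → All.lookup x∉xs x∈xs refl)
          , dec-true (x ∈? (x ∷ xs)) (here refl)

  Unique⇒length≤countTrue : ∀ {xs} {f : A → Bool} → Unique xs → ∀ ys → (∀ x → x ∈ ys) →
    (∀ x → x ∈ xs → f x ≡ true) → length xs ≤ countTrue f ys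
  Unique⇒length≤countTrue {xs} unique ys complete f-on-xs =
    ≤-trans (length≤countTrue-∈ unique ys complete)
            (countTrue-mono (λ x x∈xs → f-on-xs x (does⇒ (x ∈? xs) x∈xs)) ys)

¬¬-∀-enumerable : ∀ {A : Set} {P : A → Set} (xs : List A) → (∀ x → x ∈ xs) →
  (∀ x → ¬ ¬ P x) → ¬ ¬ (∀ x → P x)
¬¬-∀-enumerable {P = P} xs complete ¬¬P ¬∀ = all xs λ Pxs → ¬∀ λ x → All.lookup Pxs (complete x)
  where
  all : ∀ ys → ¬ ¬ All P ys
  all []       ¬all = ¬all []
  all (y ∷ ys) ¬all = ¬¬P y λ Py → all ys λ Pys → ¬all (Py ∷ Pys)

descent : (Φ : ℕ → ℕ) {a b : ℕ} → a ≤ b → (∀ j → a ≤ j → j < b → suc (Φ (suc j)) ≤ Φ j) →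
  (b ∸ a) + Φ b ≤ Φ a
descent Φ {a} = go ∘ ≤⇒≤′
  where
  go : ∀ {b} → a ≤′ b → (∀ j → a ≤ j → j < b → suc (Φ (suc j)) ≤ Φ j) → (b ∸ a) + Φ b ≤ Φ a
  go ≤′-refl _ = ≤-reflexive (cong (_+ Φ a) (n∸n≡0 a))
  go {suc b} (≤′-step a≤′b) descends = begin
    (suc b ∸ a) + Φ (suc b)   ≡⟨ cong (_+ Φ (suc b)) (+-∸-assoc 1 a≤b) ⟩
    suc (b ∸ a) + Φ (suc b)   ≡⟨ +-suc (b ∸ a) (Φ (suc b)) ⟨
    (b ∸ a) + suc (Φ (suc b)) ≤⟨ +-monoʳ-≤ (b ∸ a) (descends b a≤b ≤-refl) ⟩
    (b ∸ a) + Φ b             ≤⟨ go a≤′b (λ j a≤j j<b → descends j a≤j (m≤n⇒m≤1+n j<b)) ⟩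
    Φ a                       ∎
    where
    open ≤-Reasoning
    a≤b : a ≤ b
    a≤b = ≤′⇒≤ a≤′b

toℕ-mod : ∀ {m n} → m < suc n → toℕ (m mod suc n) ≡ m
toℕ-mod m<n = trans (toℕ-fromℕ< _) (m<n⇒m%n≡m m<n)

toℕ-mod-toℕ : ∀ {n} (i : Fin (suc n)) → toℕ i mod suc n ≡ i
toℕ-mod-toℕ i = toℕ-injective (toℕ-mod (toℕ<n i))

boundary : (G : ℕ → Bool) {m n : ℕ} → m ≤ n → G m ≡ true → G n ≡ false →
  ∃[ i ] i < n × G i ≡ true × G (suc i) ≡ false
boundary G {n = zero} z≤n gm gn with () ← trans (sym gm) gn
boundary G {m} {suc n} m≤1+n gm gn with G n in gn′
... | true  = n , ≤-refl , gn′ , gn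
... | false = let i , i<n , gi , gi+1 = boundary G m≤n gm gn′ in i , m≤n⇒m≤1+n i<n , gi , gi+1
  where
  m≤n : m ≤ n
  m≤n = s≤s⁻¹ (≤∧≢⇒< m≤1+n λ m≡1+n →
    case trans (sym (subst (λ t → G t ≡ true) m≡1+n gm)) gn of λ ())

cyclic-boundary : ∀ {n} (F : Fin n → Bool) {k₁ k₂ : Fin n} → F k₁ ≡ true → F k₂ ≡ false →
  ∃₂ λ k k⁺ → F k ≡ true × F k⁺ ≡ false × IsSuccMod n (toℕ k) (toℕ k⁺)
cyclic-boundary {suc n} F {k₁} {k₂} Fk₁ Fk₂ = by-ends (G n) (G 0) refl refl
  where
  Boundary : Set
  Boundary = ∃₂ λ k k⁺ → F k ≡ true × F k⁺ ≡ false × IsSuccMod (suc n) (toℕ k) (toℕ k⁺)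
  G : ℕ → Bool
  G i = F (i mod suc n)
  on-index : ∀ {b} k → F k ≡ b → G (toℕ k) ≡ b
  on-index k Fk = trans (cong F (toℕ-mod-toℕ k)) Fk
  linear : (∃[ i ] i < n × G i ≡ true × G (suc i) ≡ false) → Boundary
  linear (i , i<n , Gi , Gi+1) = i mod suc n , suc i mod suc n , Gi , Gi+1 ,
    inj₁ (trans (toℕ-mod (s≤s i<n)) (cong suc (sym toℕ-i)) , subst (λ t → suc t ≤ n) (sym toℕ-i) i<n)
    where
    toℕ-i : toℕ (i mod suc n) ≡ i
    toℕ-i = toℕ-mod (m≤n⇒m≤1+n i<n)
  by-ends : ∀ x y → G n ≡ x → G 0 ≡ y → Boundary
  by-ends false _     Gn _  = linear (boundary G (s≤s⁻¹ (toℕ<n k₁)) (on-index k₁ Fk₁) Gn)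
  by-ends true  false Gn G0 = n mod suc n , 0 mod suc n , Gn , G0 ,
    inj₂ (toℕ-mod {0} {n} (s≤s z≤n) , cong suc (toℕ-mod ≤-refl))
  by-ends true  true  Gn G0 = linear (let i , i<k₂ , Gi , Gi+1 = boundary G z≤n G0 (on-index k₂ Fk₂)
                                      in i , ≤-trans i<k₂ (s≤s⁻¹ (toℕ<n k₂)) , Gi , Gi+1)

module _ {ℓ w : ℕ} where

  -- Junk for m > ℓ (the layer is reduced modulo ℓ + 1); every use has m ≤ ℓ.
  row : ℕ → Fin w → V ℓ w
  row m k = m mod suc ℓ , k

  layer≤ℓ : (v : V ℓ w) → layer v ≤ ℓ
  layer≤ℓ v = s≤s⁻¹ (toℕ<n (proj₁ v))

  layer-row : ∀ {m} k → m ≤ ℓ → layer (row m k) ≡ m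
  layer-row _ m≤ℓ = toℕ-mod (s≤s m≤ℓ)

  row-layer : (v : V ℓ w) → row (layer v) (proj₂ v) ≡ v
  row-layer (i , k) = cong (_, k) (toℕ-mod-toℕ i)

  row-edge : ∀ {j k k′} → suc j ≤ ℓ → toℕ k ≡ toℕ k′ ⊎ IsSuccMod w (toℕ k′) (toℕ k) →
    Edge (row j k) (row (suc j) k′)
  row-edge {j} {k} {k′} j<ℓ adjacent =
    trans (layer-row k′ j<ℓ) (cong suc (sym (layer-row k (<⇒≤ j<ℓ)))) , adjacent

  predecessor : ∀ {v m} → layer v ≡ suc m → ∃[ u ] Edge u v × layer u ≡ m
  predecessor {v} {m} v≡1+m = row m (proj₂ v) , (trans v≡1+m (cong suc (sym u≡m)) , inj₁ refl) , u≡m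
    where
    u≡m : layer (row m (proj₂ v)) ≡ m
    u≡m = layer-row (proj₂ v) (≤-trans (n≤1+n m) (subst (_≤ ℓ) v≡1+m (layer≤ℓ v)))

  edge-< : ∀ {u v : V ℓ w} → Edge u v → layer u < layer v
  edge-< (v≡1+u , _) = ≤-reflexive (sym v≡1+u)

  layers-beyond : ∀ {x u t : V ℓ w} → Edge x u → (p : Path u t) → All (λ v → layer x < layer v) (verts p)
  layers-beyond e here        = edge-< e ∷ []
  layers-beyond e (step e′ p) = edge-< e ∷ All.map (<-trans (edge-< e)) (layers-beyond e′ p)

  _≟V_ : (u v : V ℓ w) → Dec (u ≡ v)
  _≟V_ = ≡-dec Fin._≟_ Fin._≟_

  allV-complete : (v : V ℓ w) → v ∈ allV ℓ w
  allV-complete (i , k) = ∈-cartesianProduct⁺ (∈-allFin i) (∈-allFin k)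

  rowCount : (V ℓ w → Bool) → ℕ → ℕ
  rowCount f j = countTrue (λ k → f (row j k)) (allFin w)

  countTrue-layer : ∀ {j} (f : V ℓ w → Bool) → j ≤ ℓ →
    countTrue (λ v → does (layer v ≟ j) ∧ f v) (allV ℓ w) ≡ rowCount f j
  countTrue-layer {j} f j≤ℓ =
    trans (countTrue-cartesianProduct off-row (allFin⁺ (suc ℓ)) (∈-allFin (j mod suc ℓ)) (allFin w))
          (countTrue-cong on-row (allFin w))
    where
    off-row : ∀ i k → j mod suc ℓ ≢ i → does (toℕ i ≟ j) ∧ f (i , k) ≡ false
    off-row i k j≢i = cong (_∧ f (i , k)) (dec-false (toℕ i ≟ j) λ i≡j →
      j≢i (toℕ-injective (trans (layer-row k j≤ℓ) (sym i≡j))))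
    on-row : ∀ k → does (layer (row j k) ≟ j) ∧ f (row j k) ≡ f (row j k)
    on-row k = cong (_∧ f (row j k)) (dec-true (layer (row j k) ≟ j) (layer-row k j≤ℓ))

module Road {ℓ w : ℕ} (z : Fin w) (B : VSet ℓ w) where

  sink : V ℓ w
  sink = sinkV z

  layer-sink : layer sink ≡ ℓ
  layer-sink = toℕ-fromℕ ℓ

  data FreeToSink : V ℓ w → Set where
    at-sink : B sink ≡ false → FreeToSink sink
    before  : ∀ {v u} → Edge v u → FreeToSink u → B v ≡ false → FreeToSink v

  data FreeFromBottom : V ℓ w → Set where
    at-bottom : ∀ {v} → layer v ≡ 0 → B v ≡ false → FreeFromBottom v
    after     : ∀ {u v} → Edge u v → FreeFromBottom u → B v ≡ false → FreeFromBottom v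

  FreeToSink⇒∉ : ∀ {v} → FreeToSink v → B v ≡ false
  FreeToSink⇒∉ (at-sink v∉B)    = v∉B
  FreeToSink⇒∉ (before _ _ v∉B) = v∉B

  FreeFromBottom⇒∉ : ∀ {v} → FreeFromBottom v → B v ≡ false
  FreeFromBottom⇒∉ (at-bottom _ v∉B) = v∉B
  FreeFromBottom⇒∉ (after _ _ v∉B)   = v∉B

  FreeToSink⇒path : ∀ {v} → FreeToSink v → Σ (Path v sink) λ p → All (λ y → B y ≡ false) (verts p)
  FreeToSink⇒path (at-sink v∉B) = here , v∉B ∷ []
  FreeToSink⇒path (before e free v∉B) =
    let p , avoids = FreeToSink⇒path free in step e p , v∉B ∷ avoids

  path⇒FreeToSink : ∀ {v} (p : Path v sink) → All (λ y → B y ≡ false) (verts p) → FreeToSink v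
  path⇒FreeToSink here       (v∉B ∷ []) = at-sink v∉B
  path⇒FreeToSink (step e p) (v∉B ∷ avoids) = before e (path⇒FreeToSink p avoids) v∉B

  FreeToSink-rows-above : ∀ {v m} → FreeToSink v → layer v ≤ m → m ≤ ℓ → ∃[ k ] FreeToSink (row m k)
  FreeToSink-rows-above {v} {m} free v≤m m≤ℓ with layer v ≟ m
  ... | yes refl = proj₂ v , subst FreeToSink (sym (row-layer v)) free
  FreeToSink-rows-above (at-sink _) v≤m m≤ℓ | no v≢m =
    contradiction (≤-antisym v≤m (subst (_ ≤_) (sym layer-sink) m≤ℓ)) v≢m
  FreeToSink-rows-above (before e free _) v≤m m≤ℓ | no v≢m =
    FreeToSink-rows-above free (subst (_≤ _) (sym (proj₁ e)) (≤∧≢⇒< v≤m v≢m)) m≤ℓ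

  FreeFromBottom-rows-below : ∀ {v m} → FreeFromBottom v → m ≤ layer v → ∃[ k ] FreeFromBottom (row m k)
  FreeFromBottom-rows-below {v} {m} free m≤v with m ≟ layer v
  ... | yes refl = proj₂ v , subst FreeFromBottom (sym (row-layer v)) free
  FreeFromBottom-rows-below (at-bottom v≡0 _) m≤v | no m≢v =
    contradiction (≤-antisym m≤v (subst (_≤ _) (sym v≡0) z≤n)) m≢v
  FreeFromBottom-rows-below (after e free _) m≤v | no m≢v =
    FreeFromBottom-rows-below free (s≤s⁻¹ (subst (_ ≤_) (proj₁ e) (≤∧≢⇒< m≤v m≢v)))

  FreeFromBottom-below-lowest : ∀ {a} → (∀ x → x ∈ₛ B → a ≤ layer x) →
    ∀ n {v} → layer v ≡ n → n ≤ a → B v ≡ false → FreeFromBottom v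
  FreeFromBottom-below-lowest above-a zero    v≡0   _   v∉B = at-bottom v≡0 v∉B
  FreeFromBottom-below-lowest above-a (suc m) v≡1+m m<a v∉B =
    let u , e , u≡m = predecessor v≡1+m
        u∉B = ¬-not λ u∈B → <⇒≱ m<a (subst (_ ≤_) u≡m (above-a u u∈B))
    in after e (FreeFromBottom-below-lowest above-a m u≡m (<⇒≤ m<a) u∉B) v∉B

  source⇒bottom : ∀ {s : V ℓ w} → IsSource z s → layer s ≡ 0
  source⇒bottom {Fin.zero  , _} _ = refl
  source⇒bottom {Fin.suc i , _} (s∈road , no-in-edge) =
    let u , e , _ = predecessor {m = toℕ i} refl in ⊥-elim (no-in-edge u e (step e s∈road))

  road-above-highest⇒FreeToSink : ∀ {v} → (∀ x → x ∈ₛ B → layer x ≤ layer v) → InRoad z v →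
    B v ≡ false → FreeToSink v
  road-above-highest⇒FreeToSink below-v here       v∉B = at-sink v∉B
  road-above-highest⇒FreeToSink below-v (step e p) v∉B = before e (path⇒FreeToSink p avoids) v∉B
    where
    avoids = All.map (λ {x} v<x → ¬-not λ x∈B → <⇒≱ v<x (below-v x x∈B)) (layers-beyond e p)

  FreeEntry : V ℓ w → Set
  FreeEntry x = layer x ≡ 0 ⊎ ∃[ y ] Edge y x × FreeFromBottom y

  FreeExit : V ℓ w → Set
  FreeExit x = x ≡ sink ⊎ ∃[ y ] Edge x y × FreeToSink y

  FreeExit⇒FreeToSink-rows-above : ∀ {x m} → FreeExit x → layer x < m → m ≤ ℓ →
    ∃[ k ] FreeToSink (row m k)
  FreeExit⇒FreeToSink-rows-above {m = m} (inj₁ refl) x<m m≤ℓ =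
    contradiction (subst (m ≤_) (sym layer-sink) m≤ℓ) (<⇒≱ x<m)
  FreeExit⇒FreeToSink-rows-above {m = m} (inj₂ (y , e , free)) x<m m≤ℓ =
    FreeToSink-rows-above free (subst (_≤ m) (sym (proj₁ e)) x<m) m≤ℓ

  FreeEntry⇒FreeFromBottom : ∀ {v} → FreeEntry v → B v ≡ false → FreeFromBottom v
  FreeEntry⇒FreeFromBottom (inj₁ v≡0)         v∉B = at-bottom v≡0 v∉B
  FreeEntry⇒FreeFromBottom (inj₂ (_ , e , up)) v∉B = after e up v∉B

  private
    OnlyBlocker : V ℓ w → List (V ℓ w) → Set
    OnlyBlocker x = All (λ v → v ∈ₛ B → v ≡ x)

    only-blocker⇒FreeExit : ∀ {x} (p : Path x sink) → OnlyBlocker x (verts p) → FreeExit x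
    only-blocker⇒FreeExit here _ = inj₁ refl
    only-blocker⇒FreeExit (step {v = y} e p) (_ ∷ only-x) = inj₂ (y , e , path⇒FreeToSink p avoids)
      where
      avoids = All.zipWith (λ { {v} (v≡x , x<v) → ¬-not λ v∈B → <-irrefl (cong layer (sym (v≡x v∈B))) x<v })
                           (only-x , layers-beyond e p)

    only-blocker⇒FreeEntry×FreeExit : ∀ {x u} (p : Path u sink) → OnlyBlocker x (verts p) →
      Any (_∈ₛ B) (verts p) → FreeEntry u → FreeEntry x × FreeExit x
    only-blocker⇒FreeEntry×FreeExit here (u≡x ∷ []) (here u∈B) entry with refl ← u≡x u∈B =
      entry , inj₁ refl
    only-blocker⇒FreeEntry×FreeExit (step {u = u} e p) (u≡x ∷ only-x) meets entry with B u Bool.≟ true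
    ... | yes u∈B with refl ← u≡x u∈B = entry , only-blocker⇒FreeExit (step e p) (u≡x ∷ only-x)
    ... | no u∉B with meets
    ...   | here u∈B     = contradiction u∈B u∉B
    ...   | there meets′ = only-blocker⇒FreeEntry×FreeExit p only-x meets′
                               (inj₂ (u , e , FreeEntry⇒FreeFromBottom entry (¬-not u∉B)))

  minimal⇒FreeEntry×FreeExit : MinimalBlocking z B → ∀ {x} → x ∈ₛ B → ¬ ¬ (FreeEntry x × FreeExit x)
  minimal⇒FreeEntry×FreeExit (blocking , minimal) {x} x∈B ¬entry×exit =
    minimal B′ B′⊆B (x , x∈B , x∉B′) (B′-road , B′-blocks)
    where
    B′ : VSet ℓ w
    B′ v = B v ∧ not (does (v ≟V x))
    B′⊆B : B′ ⊆ₛ B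
    B′⊆B v = ∧-conicalˡ (B v) _
    x∉B′ : ¬ x ∈ₛ B′
    x∉B′ x∈B′ = contradiction (∧-conicalʳ (B x) _ x∈B′) (not-¬ (cong not (dec-true (x ≟V x) refl)))
    B′-road : SubsetOfRoad z B′
    B′-road v v∈B′ = proj₁ blocking v (B′⊆B v v∈B′)
    only-x : ∀ {v} → ¬ v ∈ₛ B′ → v ∈ₛ B → v ≡ x
    only-x {v} v∉B′ v∈B with v ≟V x
    ... | yes v≡x = v≡x
    ... | no  _   = contradiction (trans (Bool.∧-identityʳ (B v)) v∈B) v∉B′
    B′-blocks : ∀ s → IsSource z s → (p : Path s sink) → Any (_∈ₛ B′) (verts p)
    B′-blocks s source p with any? (λ v → B′ v Bool.≟ true) (verts p)
    ... | yes meets = meets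
    ... | no ¬meets = ⊥-elim (¬entry×exit (only-blocker⇒FreeEntry×FreeExit p
                        (All.map only-x (¬Any⇒All¬ _ ¬meets)) (proj₂ blocking s source p)
                        (inj₁ (source⇒bottom source))))

  free-or-blocked : ∀ {u} (free? : Dec (FreeToSink u)) → (B u ≡ false → FreeToSink u) →
    does free? ∨ B u ≡ true
  free-or-blocked {u} free? free with B u
  ... | true  = ∨-zeroʳ (does free?)
  ... | false = trans (∨-identityʳ (does free?)) (dec-true free? (free refl))

  blockersFrom : ℕ → ℕ
  blockersFrom j = countTrue (λ v → does (j ≤? layer v) ∧ B v) (allV ℓ w)

  blockersFrom≤card : ∀ j → blockersFrom j ≤ card B
  blockersFrom≤card j = countTrue-mono (λ v → ∧-conicalʳ _ (B v)) (allV ℓ w)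

  rowCount+blockersFrom : ∀ {j} → j ≤ ℓ → rowCount B j + blockersFrom (suc j) ≡ blockersFrom j
  rowCount+blockersFrom {j} j≤ℓ = begin
    rowCount B j + blockersFrom (suc j)
      ≡⟨ cong (_+ blockersFrom (suc j)) (countTrue-layer B j≤ℓ) ⟨
    countTrue at-j (allV ℓ w) + blockersFrom (suc j)
      ≡⟨ countTrue-disjoint disjoint (allV ℓ w) ⟩
    countTrue (λ v → at-j v ∨ (does (suc j ≤? layer v) ∧ B v)) (allV ℓ w)
      ≡⟨ countTrue-cong at-or-above (allV ℓ w) ⟩
    blockersFrom j ∎
    where
    open ≡-Reasoning
    at-j : V ℓ w → Bool
    at-j v = does (layer v ≟ j) ∧ B v
    disjoint : ∀ v → at-j v ∧ (does (suc j ≤? layer v) ∧ B v) ≡ false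
    disjoint v with layer v ≟ j
    ... | no v≢j =
      cong (λ c → (c ∧ B v) ∧ (does (suc j ≤? layer v) ∧ B v)) (dec-false (layer v ≟ j) v≢j)
    ... | yes v≡j = trans
      (cong (λ c → at-j v ∧ (c ∧ B v)) (dec-false (suc j ≤? layer v) (<-irrefl (sym v≡j))))
      (∧-zeroʳ (at-j v))
    j≤⇔ : ∀ v → (layer v ≡ j ⊎ j < layer v) ⇔ j ≤ layer v
    j≤⇔ v = mk⇔ [ ≤-reflexive ∘ sym , <⇒≤ ]′ λ j≤v → [ inj₂ , inj₁ ∘ sym ]′ (m≤n⇒m<n∨m≡n j≤v)
    at-or-above : ∀ v → at-j v ∨ (does (suc j ≤? layer v) ∧ B v) ≡ does (j ≤? layer v) ∧ B v
    at-or-above v = trans (sym (∧-distribʳ-∨ (B v) (does (layer v ≟ j)) (does (suc j ≤? layer v))))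
      (cong (_∧ B v) (does-⇔ (j≤⇔ v) (layer v ≟ j ⊎-dec suc j ≤? layer v) (j ≤? layer v)))

  module _ (blocking : Blocking z B) where

    free-disjoint : ∀ {v} → FreeFromBottom v → FreeToSink v → ⊥
    free-disjoint (at-bottom v≡0 _) free =
      All¬⇒¬Any (All.map not-¬ avoids) (proj₂ blocking _ (p , no-in-edge) p)
      where
      p = proj₁ (FreeToSink⇒path free)
      avoids = proj₂ (FreeToSink⇒path free)
      no-in-edge : ∀ u → Edge u _ → ¬ InRoad z u
      no-in-edge u (v≡1+u , _) _ = 0≢1+n (trans (sym v≡0) v≡1+u)
    free-disjoint (after e up v∉B) free = free-disjoint up (before e free (FreeFromBottom⇒∉ up))

    FreeEntry⇒¬FreeToSink-rows-below : ∀ {x m} → x ∈ₛ B → FreeEntry x → m ≤ layer x →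
      ∃[ k ] ¬ FreeToSink (row m k)
    FreeEntry⇒¬FreeToSink-rows-below {x} {m} x∈B entry m≤x with m ≟ layer x | entry
    ... | yes refl | _ = proj₂ x , λ free → not-¬ (FreeToSink⇒∉ (subst FreeToSink (row-layer x) free)) x∈B
    ... | no m≢x | inj₁ x≡0 = contradiction (trans (n≤0⇒n≡0 (subst (m ≤_) x≡0 m≤x)) (sym x≡0)) m≢x
    ... | no m≢x | inj₂ (y , e , up) =
      let k , up′ = FreeFromBottom-rows-below up (s≤s⁻¹ (subst (m <_) (proj₁ e) (≤∧≢⇒< m≤x m≢x)))
      in k , free-disjoint up′

  module _ (free? : ∀ v → Dec (FreeToSink v)) where

    free : V ℓ w → Bool
    free v = does (free? v)

    free-row-shrinks : ∀ {j} → suc j ≤ ℓ →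
      ∃[ k ] FreeToSink (row (suc j) k) → ∃[ k ] ¬ FreeToSink (row (suc j) k) →
      suc (rowCount free (suc j)) ≤ rowCount free j + rowCount B j
    free-row-shrinks {j} j<ℓ (k₁ , free-k₁) (k₂ , ¬free-k₂)
      with k , k⁺ , free-k , ¬free-k⁺ , k⁺≡1+k ← cyclic-boundary (λ k → free (row (suc j) k))
             (dec-true (free? _) free-k₁) (dec-false (free? _) ¬free-k₂) = begin-strict
      rowCount free (suc j)
        <⟨ countTrue-mono-< (λ k → feeds (inj₁ refl)) (allFin w)
             (Any.map (λ { refl → ¬free-k⁺ , feeds (inj₂ k⁺≡1+k) free-k }) (∈-allFin k⁺)) ⟩
      countTrue (λ k → free (row j k) ∨ B (row j k)) (allFin w)
        ≤⟨ countTrue-∨ (λ k → free (row j k)) (λ k → B (row j k)) (allFin w) ⟩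
      rowCount free j + rowCount B j ∎
      where
      open ≤-Reasoning
      feeds : ∀ {i i′} → toℕ i ≡ toℕ i′ ⊎ IsSuccMod w (toℕ i′) (toℕ i) →
        free (row (suc j) i′) ≡ true → free (row j i) ∨ B (row j i) ≡ true
      feeds adjacent free-i′ = free-or-blocked (free? _)
        (before (row-edge j<ℓ adjacent) (does⇒ (free? _) free-i′))

    top-row≤free+blocked : ∀ {b L} → (∀ x → x ∈ₛ B → layer x ≤ b) → b ≤ ℓ → EnumRoadLayer z b L →
      length L ≤ rowCount free b + rowCount B b
    top-row≤free+blocked {b} {L} below-b b≤ℓ (unique , enumerates) = begin
      length L
        ≤⟨ Unique⇒length≤countTrue _≟V_ unique (allV ℓ w) allV-complete on-row-b ⟩
      countTrue (λ v → at-b v ∧ (free v ∨ B v)) (allV ℓ w)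
        ≡⟨ countTrue-cong (λ v → ∧-distribˡ-∨ (at-b v) (free v) (B v)) (allV ℓ w) ⟩
      countTrue (λ v → (at-b v ∧ free v) ∨ (at-b v ∧ B v)) (allV ℓ w)
        ≤⟨ countTrue-∨ (λ v → at-b v ∧ free v) (λ v → at-b v ∧ B v) (allV ℓ w) ⟩
      countTrue (λ v → at-b v ∧ free v) (allV ℓ w) + countTrue (λ v → at-b v ∧ B v) (allV ℓ w)
        ≡⟨ cong₂ _+_ (countTrue-layer free b≤ℓ) (countTrue-layer B b≤ℓ) ⟩
      rowCount free b + rowCount B b ∎
      where
      open ≤-Reasoning
      at-b : V ℓ w → Bool
      at-b v = does (layer v ≟ b)
      on-row-b : ∀ v → v ∈ L → at-b v ∧ (free v ∨ B v) ≡ true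
      on-row-b v v∈L with v∈road , v≡b ← Equivalence.to (enumerates v) v∈L =
        trans (cong (_∧ (free v ∨ B v)) (dec-true (layer v ≟ b) v≡b))
              (free-or-blocked (free? v) (road-above-highest⇒FreeToSink
                (λ x x∈B → subst (layer x ≤_) (sym v≡b) (below-b x x∈B)) v∈road))

    free-row-lowest≡0 : Blocking z B → ∀ {a} → (∀ x → x ∈ₛ B → a ≤ layer x) → a ≤ ℓ →
      rowCount free a ≡ 0
    free-row-lowest≡0 blocking {a} above-a a≤ℓ = countTrue-false not-free (allFin w)
      where
      not-free : ∀ k → free (row a k) ≡ false
      not-free k = dec-false (free? (row a k)) λ free-k → free-disjoint blocking
        (FreeFromBottom-below-lowest above-a a (layer-row k a≤ℓ) ≤-refl (FreeToSink⇒∉ free-k)) free-k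

    spread+top-row≤card : Blocking z B → ∀ {xa xb L} → xa ∈ₛ B → xb ∈ₛ B →
      (∀ x → x ∈ₛ B → layer xa ≤ layer x) → (∀ x → x ∈ₛ B → layer x ≤ layer xb) →
      EnumRoadLayer z (layer xb) L → FreeExit xa → FreeEntry xb →
      (layer xb ∸ layer xa) + length L ≤ card B
    spread+top-row≤card blocking {xa} {xb} {L} xa∈B xb∈B above-a below-b enum exit-a entry-b = begin
      (b ∸ a) + length L  ≤⟨ +-monoʳ-≤ (b ∸ a) top ⟩
      (b ∸ a) + Φ b       ≤⟨ descent Φ a≤b descends ⟩
      Φ a                 ≡⟨ cong (_+ blockersFrom a) (free-row-lowest≡0 blocking above-a a≤ℓ) ⟩
      blockersFrom a      ≤⟨ blockersFrom≤card a ⟩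
      card B              ∎
      where
      open ≤-Reasoning
      a = layer xa
      b = layer xb
      a≤b = above-a xb xb∈B
      b≤ℓ = layer≤ℓ xb
      a≤ℓ = ≤-trans a≤b b≤ℓ
      Φ : ℕ → ℕ
      Φ j = rowCount free j + blockersFrom j
      top : length L ≤ Φ b
      top = ≤-trans (top-row≤free+blocked below-b b≤ℓ enum) (+-monoʳ-≤ (rowCount free b)
              (≤-trans (m≤m+n _ _) (≤-reflexive (rowCount+blockersFrom b≤ℓ))))
      descends : ∀ j → a ≤ j → j < b → suc (Φ (suc j)) ≤ Φ j
      descends j a≤j j<b = begin
        suc (rowCount free (suc j)) + blockersFrom (suc j)
          ≤⟨ +-monoˡ-≤ (blockersFrom (suc j)) (free-row-shrinks j<ℓ
               (FreeExit⇒FreeToSink-rows-above exit-a (s≤s a≤j) j<ℓ)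
               (FreeEntry⇒¬FreeToSink-rows-below blocking xb∈B entry-b j<b)) ⟩
        (rowCount free j + rowCount B j) + blockersFrom (suc j)
          ≡⟨ +-assoc (rowCount free j) (rowCount B j) (blockersFrom (suc j)) ⟩
        rowCount free j + (rowCount B j + blockersFrom (suc j))
          ≡⟨ cong (rowCount free j +_) (rowCount+blockersFrom (<⇒≤ j<ℓ)) ⟩
        Φ j ∎
        where j<ℓ = ≤-trans j<b b≤ℓ

lemma4p4 : (w ℓ : ℕ) → w ∸ 1 ≤ ℓ → (z : Fin w) → (B : VSet ℓ w) →
    MinimalBlocking z B →
    (a b d : ℕ) → LowestLayer B a → HighestLayer B b → d ≡ suc (b ∸ a) →
    (q : ℕ) → (L : List (V ℓ w)) → EnumRoadLayer z b L → length L ≡ q →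
    d + q ∸ 1 ≤ card B
-- FreeToSink is decidable only classically and minimality is a negative hypothesis, but the goal
-- is a decidable inequality, so the argument runs in the double-negation monad.
lemma4p4 w ℓ _ z B minimal _ _ _ ((xa , xa∈B , refl) , above-a) ((xb , xb∈B , refl) , below-b) refl _ L enum refl =
  decidable-stable (_ ≤? _) do
    free? ← ¬¬-∀-enumerable (allV ℓ w) allV-complete λ _ → ¬¬-excluded-middle
    _ , exit-a ← minimal⇒FreeEntry×FreeExit minimal xa∈B
    entry-b , _ ← minimal⇒FreeEntry×FreeExit minimal xb∈B
    pure (spread+top-row≤card free? (proj₁ minimal) xa∈B xb∈B above-a below-b enum exit-a entry-b)
  where
  open Road z B
  open RawMonad ¬¬-Monad
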